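{- Let $a$ be a positive integer and $n\geq 0$. If $s=2a$, then \[ac(n,s)=\sum_{\substack{r,t\geq 0\\ r+2t=n-3a}}2^a\binom{a+r-1}{r}\binom{a+t-1}{t},\] and if $s=2a+1$, then \[ac(n,s)=\sum_{\substack{r,t\geq 0\\ r+2t=n-3a-1}}2^a\binom{a+r}{r}\binom{a+t-1}{t}.\]
   Context: A composition of $n$ of length $s$ is a sequence $\sigma=(\sigma_1,\ldots,\sigma_s)$ of positive integers with $\sum_i\sigma_i=n$. A composition is anti-palindromic if $\sigma_i\neq\sigma_{s-i+1}$ for all $i$ with $i\neq\frac{s+1}{2}$. $ac(n,s)$ denotes the number of anti-palindromic compositions of $n$ of length $s$. Sums with no terms are $0$. -}

module Defs where

open import Data.Nat using (ℕ; zero; suc; _+_; _*_; _^_; _<_; _≟_)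
open import Data.Nat.Combinatorics using (_C_)
open import Data.Nat.Properties using (_<?_)
open import Data.Fin using (Fin; toℕ; opposite)
open import Data.Vec using (Vec; []; _∷_; lookup)
import Data.Vec as Vec
open import Data.List using (List; []; _∷_; upTo; concatMap; map; filter; length; cartesianProduct)
open import Data.Nat.ListAction using (sum)
open import Data.Product using (_×_; _,_; proj₁; proj₂)
open import Relation.Binary.PropositionalEquality using (_≡_; _≢_)
open import Relation.Nullary using (Dec; yes; no; ¬_)
open import Relation.Nullary.Decidable using (_×-dec_; ¬?)
open import Data.Vec.Relation.Unary.All using (All; all?)
open import Data.Fin.Properties using ()
  renaming (all? to allFin?)

IsComposition : (n s : ℕ) → Vec ℕ s → Set
IsComposition n s σ = All (λ x → 0 < x) σ × Vec.sum σ ≡ n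

-- Anti-palindromic: σ_i ≠ σ_{s-i+1} for every (1-indexed) i with i ≠ (s+1)/2.
-- In 0-indexed form: for every i : Fin s with 2·i+1 ≠ s,
-- σ[i] ≠ σ[opposite i] (opposite i = s-1-i).
IsAntiPalindromic : (s : ℕ) → Vec ℕ s → Set
IsAntiPalindromic s σ =
  (i : Fin s) → 2 * toℕ i + 1 ≢ s → lookup σ i ≢ lookup σ (opposite i)

isComposition? : (n s : ℕ) (σ : Vec ℕ s) → Dec (IsComposition n s σ)
isComposition? n s σ = all? (λ x → 0 <? x) σ ×-dec (Vec.sum σ ≟ n)

isAntiPalindromic? : (s : ℕ) (σ : Vec ℕ s) → Dec (IsAntiPalindromic s σ)
isAntiPalindromic? s σ =
  allFin? (λ i → (¬? (2 * toℕ i + 1 ≟ s)) →-dec ¬? (lookup σ i ≟ lookup σ (opposite i)))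
  where
  _→-dec_ : {A B : Set} → Dec A → Dec B → Dec (A → B)
  yes a →-dec yes b = yes (λ _ → b)
  yes a →-dec no ¬b = no (λ f → ¬b (f a))
  no ¬a →-dec _ = yes (λ a → Data.Empty.⊥-elim (¬a a))
    where import Data.Empty

-- All vectors of length s with entries in {0,…,n}  (every composition of n
-- of length s is among them).
vecsUpTo : (n s : ℕ) → List (Vec ℕ s)
vecsUpTo n zero = [] ∷ []
vecsUpTo n (suc s) = concatMap (λ x → map (x ∷_) (vecsUpTo n s)) (upTo (suc n))

ac : ℕ → ℕ → ℕ
ac n s = length (filter (λ σ → isComposition? n s σ ×-dec isAntiPalindromic? s σ)
                        (vecsUpTo n s))

-- Σ over pairs (r,t) of naturals with r + 2t + k = n of f r t
-- (i.e. r + 2t = n - k, the empty sum when n < k).  All such r,t are ≤ n.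
sumR2T : (n k : ℕ) → (ℕ → ℕ → ℕ) → ℕ
sumR2T n k f =
  sum (map (λ p → f (proj₁ p) (proj₂ p))
           (filter (λ p → proj₁ p + 2 * proj₂ p + k ≟ n)
                   (cartesianProduct (upTo (suc n)) (upTo (suc n)))))

-- Removing the first and last entries x ≠ y of an anti-palindromic composition of length
-- s + 2 leaves an anti-palindromic composition of length s, and conversely. Ordered pairs of
-- distinct positive integers are counted by F(z)² − F(z²) = 2z³/((1 − z)(1 − z²)), where
-- F(z) = z/(1 − z), so the generating functions A_s(z) = Σₙ ac(n,s) zⁿ satisfy
-- A_{s+2} = 2z³/((1 − z)(1 − z²)) · A_s with A_0 = 1 and A_1 = F. Hence
-- A_{2a} = 2^a z^{3a} (1 − z)^{−a} (1 − z²)^{−a} and A_{2a+1} = 2^a z^{3a+1} (1 − z)^{−a−1} (1 − z²)^{−a},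
-- and expanding (1 − z)^{−b} = Σ_r C(b+r−1, r) z^r gives the two sums.

module Submission where

open import Data.Bool using (Bool; true; false; if_then_else_; _∧_)
open import Data.Bool.Properties using (∧-zeroʳ)
open import Data.Fin using (Fin; zero; suc; toℕ; fromℕ; inject₁; opposite)
open import Data.Fin.Properties using (toℕ-inject₁)
open import Data.Fin.Relation.Unary.Top using (view; ‵fromℕ; ‵inject₁)
open import Data.List using (List; []; _∷_; _++_; map; filter; length; concatMap; applyUpTo; upTo; cartesianProduct)
open import Data.List.Properties using (map-++; map-cong; map-∘)
open import Data.Nat
open import Data.Nat.Combinatorics using (_C_; nCk+nC[k+1]≡[n+1]C[k+1]; k>n⇒nCk≡0)
open import Data.Nat.ListAction using (sum)
open import Data.Nat.ListAction.Properties using (sum-++)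
open import Data.Nat.Properties
open import Data.Nat.Tactic.RingSolver using (solve-∀)
open import Algebra.Properties.CommutativeSemigroup +-commutativeSemigroup
  using () renaming (interchange to +-interchange)
open import Data.Product using (_×_; _,_; proj₁; proj₂)
open import Data.Vec using (Vec; []; _∷_; _∷ʳ_; lookup)
import Data.Vec as Vec
open import Data.Vec.Relation.Unary.All using (All; []; _∷_)
open import Function using (_∘_; const)
open import Function.Bundles using (_⇔_; mk⇔)
open import Relation.Binary.Definitions using (tri<; tri≈; tri>)
open import Relation.Binary.PropositionalEquality
open import Relation.Nullary using (Dec; does)
open import Relation.Nullary.Decidable using (_×-dec_; ¬?; dec-true; dec-false; does-⇔)
open import Defs

open ≡-Reasoning

infixl 7 _when_
_when_ : ℕ → Bool → ℕ
x when b = if b then x else 0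

*-when : ∀ c x b → c * (x when b) ≡ c * x when b
*-when c x true  = refl
*-when c x false = *-zeroʳ c

when-∧ : ∀ x a b → x when (a ∧ b) ≡ x when b when a
when-∧ x true  b = refl
when-∧ x false b = refl

-- does (suc r ≤? suc n) computes to r <ᵇ suc n rather than to does (r ≤? n).
<ᵇ-suc : ∀ r n → (r <ᵇ suc n) ≡ (r ≤ᵇ n)
<ᵇ-suc zero    n = refl
<ᵇ-suc (suc r) n = refl

2*suc≟ : ∀ t m → does (2 * suc t ≟ m) ≡ does (2 + 2 * t ≟ m)
2*suc≟ t m = cong (λ k → does (k ≟ m)) (*-suc 2 t)

Seq : Set
Seq = ℕ → ℕ

∑< : ℕ → Seq → ℕ
∑< zero    f = 0
∑< (suc n) f = f 0 + ∑< n (f ∘ suc)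

syntax ∑< n (λ i → e) = ∑[ i < n ] e

∑-cong : ∀ n {f g : Seq} → f ≗ g → ∑< n f ≡ ∑< n g
∑-cong zero    f≗g = refl
∑-cong (suc n) f≗g = cong₂ _+_ (f≗g 0) (∑-cong n (f≗g ∘ suc))

∑-zero : ∀ n {f : Seq} → f ≗ const 0 → ∑< n f ≡ 0
∑-zero zero    f≗0 = refl
∑-zero (suc n) f≗0 = cong₂ _+_ (f≗0 0) (∑-zero n (f≗0 ∘ suc))

∑-+ : ∀ n (f g : Seq) → ∑[ i < n ] (f i + g i) ≡ ∑< n f + ∑< n g
∑-+ zero    f g = refl
∑-+ (suc n) f g = begin
  f 0 + g 0 + ∑[ i < n ] (f (suc i) + g (suc i))
    ≡⟨ cong (f 0 + g 0 +_) (∑-+ n (f ∘ suc) (g ∘ suc)) ⟩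
  f 0 + g 0 + (∑< n (f ∘ suc) + ∑< n (g ∘ suc))
    ≡⟨ +-interchange (f 0) (g 0) _ _ ⟩
  f 0 + ∑< n (f ∘ suc) + (g 0 + ∑< n (g ∘ suc)) ∎

∑-*ˡ : ∀ n c (f : Seq) → ∑[ i < n ] (c * f i) ≡ c * ∑< n f
∑-*ˡ zero    c f = sym (*-zeroʳ c)
∑-*ˡ (suc n) c f = trans (cong (c * f 0 +_) (∑-*ˡ n c (f ∘ suc))) (sym (*-distribˡ-+ c (f 0) _))

∑-comm : ∀ n m (F : ℕ → Seq) → ∑[ i < n ] ∑< m (F i) ≡ ∑[ j < m ] ∑[ i < n ] F i j
∑-comm zero    m F = sym (∑-zero m (λ _ → refl))
∑-comm (suc n) m F = trans (cong (∑< m (F 0) +_) (∑-comm n m (F ∘ suc))) (sym (∑-+ m (F 0) _))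

∑-indicator : ∀ {m N} → m < N → ∑[ i < N ] (1 when does (i ≟ m)) ≡ 1
∑-indicator {zero}  {suc N} _         = cong suc (∑-zero N (λ _ → refl))
∑-indicator {suc m} {suc N} (s<s m<N) = ∑-indicator m<N

module _ {A : Set} where

  ∑ᴸ : (A → ℕ) → List A → ℕ
  ∑ᴸ F xs = sum (map F xs)

  ∑ᴸ-cong : ∀ {F G : A → ℕ} → F ≗ G → ∀ xs → ∑ᴸ F xs ≡ ∑ᴸ G xs
  ∑ᴸ-cong F≗G xs = cong sum (map-cong F≗G xs)

  ∑ᴸ-++ : ∀ (F : A → ℕ) xs ys → ∑ᴸ F (xs ++ ys) ≡ ∑ᴸ F xs + ∑ᴸ F ys
  ∑ᴸ-++ F xs ys = trans (cong sum (map-++ F xs ys)) (sum-++ (map F xs) (map F ys))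

  ∑ᴸ-when : ∀ (F : A → ℕ) b xs → ∑ᴸ (λ x → F x when b) xs ≡ ∑ᴸ F xs when b
  ∑ᴸ-when F true  xs = refl
  ∑ᴸ-when F false []       = refl
  ∑ᴸ-when F false (x ∷ xs) = ∑ᴸ-when F false xs

  ∑ᴸ-∑ : ∀ N (F : A → Seq) xs → ∑ᴸ (λ x → ∑< N (F x)) xs ≡ ∑[ i < N ] ∑ᴸ (λ x → F x i) xs
  ∑ᴸ-∑ N F []       = sym (∑-zero N (λ _ → refl))
  ∑ᴸ-∑ N F (x ∷ xs) = trans (cong (∑< N (F x) +_) (∑ᴸ-∑ N F xs)) (sym (∑-+ N (F x) _))

  ∑ᴸ-filter : ∀ {p} {P : A → Set p} (P? : ∀ x → Dec (P x)) (F : A → ℕ) xs →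
              ∑ᴸ F (filter P? xs) ≡ ∑ᴸ (λ x → F x when does (P? x)) xs
  ∑ᴸ-filter P? F []       = refl
  ∑ᴸ-filter P? F (x ∷ xs) with does (P? x)
  ... | true  = cong (F x +_) (∑ᴸ-filter P? F xs)
  ... | false = ∑ᴸ-filter P? F xs

  length-filter : ∀ {p} {P : A → Set p} (P? : ∀ x → Dec (P x)) xs →
                  length (filter P? xs) ≡ ∑ᴸ (λ x → 1 when does (P? x)) xs
  length-filter P? xs = trans (length-as-∑ᴸ (filter P? xs)) (∑ᴸ-filter P? (const 1) xs)
    where
    length-as-∑ᴸ : ∀ ys → length ys ≡ ∑ᴸ (const 1) ys
    length-as-∑ᴸ []       = refl
    length-as-∑ᴸ (y ∷ ys) = cong suc (length-as-∑ᴸ ys)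

∑ᴸ-map : ∀ {A B : Set} (F : B → ℕ) (g : A → B) xs → ∑ᴸ F (map g xs) ≡ ∑ᴸ (F ∘ g) xs
∑ᴸ-map F g xs = cong sum (sym (map-∘ xs))

∑ᴸ-concatMap : ∀ {A B : Set} (F : B → ℕ) (g : A → List B) xs →
               ∑ᴸ F (concatMap g xs) ≡ ∑ᴸ (∑ᴸ F ∘ g) xs
∑ᴸ-concatMap F g []       = refl
∑ᴸ-concatMap F g (x ∷ xs) =
  trans (∑ᴸ-++ F (g x) (concatMap g xs)) (cong (∑ᴸ F (g x) +_) (∑ᴸ-concatMap F g xs))

∑ᴸ-applyUpTo : ∀ {A : Set} (F : A → ℕ) (g : ℕ → A) N → ∑ᴸ F (applyUpTo g N) ≡ ∑< N (F ∘ g)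
∑ᴸ-applyUpTo F g zero    = refl
∑ᴸ-applyUpTo F g (suc N) = cong (F (g 0) +_) (∑ᴸ-applyUpTo F (g ∘ suc) N)

∑ᴸ-upTo : ∀ (F : Seq) N → ∑ᴸ F (upTo N) ≡ ∑< N F
∑ᴸ-upTo F = ∑ᴸ-applyUpTo F (λ i → i)

∑ᴸ-cartesianProduct : ∀ {A B : Set} (F : A × B → ℕ) xs ys →
  ∑ᴸ F (cartesianProduct xs ys) ≡ ∑ᴸ (λ x → ∑ᴸ (λ y → F (x , y)) ys) xs
∑ᴸ-cartesianProduct F []       ys = refl
∑ᴸ-cartesianProduct F (x ∷ xs) ys =
  trans (∑ᴸ-++ F (map (x ,_) ys) (cartesianProduct xs ys))
        (cong₂ _+_ (∑ᴸ-map F (x ,_) ys) (∑ᴸ-cartesianProduct F xs ys))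

-- Power series

-- A sequence stands for its generating function: ⊛ is the Cauchy product, shift k
-- multiplies by z^k and stretch substitutes z² for z.
infixr 6 _·_
infixl 7 _⊛_

_·_ : ℕ → Seq → Seq
(c · f) n = c * f n

_⊛_ : Seq → Seq → Seq
(f ⊛ g) zero    = f 0 * g 0
(f ⊛ g) (suc n) = f 0 * g (suc n) + (f ∘ suc ⊛ g) n

ε : Seq
ε zero    = 1
ε (suc n) = 0

geometric : Seq
geometric = const 1

⊛-cong : ∀ {f f′ g g′ : Seq} → f ≗ f′ → g ≗ g′ → f ⊛ g ≗ f′ ⊛ g′
⊛-cong f≗f′ g≗g′ zero    = cong₂ _*_ (f≗f′ 0) (g≗g′ 0)
⊛-cong f≗f′ g≗g′ (suc n) =
  cong₂ _+_ (cong₂ _*_ (f≗f′ 0) (g≗g′ (suc n))) (⊛-cong (f≗f′ ∘ suc) g≗g′ n)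

⊛-congˡ : ∀ {f f′ : Seq} g → f ≗ f′ → f ⊛ g ≗ f′ ⊛ g
⊛-congˡ g f≗f′ = ⊛-cong f≗f′ (λ _ → refl)

⊛-congʳ : ∀ f {g g′ : Seq} → g ≗ g′ → f ⊛ g ≗ f ⊛ g′
⊛-congʳ f = ⊛-cong (λ _ → refl)

⊛-suc-last : ∀ (f g : Seq) n → (f ⊛ g) (suc n) ≡ (f ⊛ g ∘ suc) n + f (suc n) * g 0
⊛-suc-last f g zero    = refl
⊛-suc-last f g (suc n) = begin
  f 0 * g (2 + n) + (f ∘ suc ⊛ g) (suc n)
    ≡⟨ cong (f 0 * g (2 + n) +_) (⊛-suc-last (f ∘ suc) g n) ⟩
  f 0 * g (2 + n) + ((f ∘ suc ⊛ g ∘ suc) n + f (2 + n) * g 0)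
    ≡⟨ +-assoc (f 0 * g (2 + n)) _ _ ⟨
  f 0 * g (2 + n) + (f ∘ suc ⊛ g ∘ suc) n + f (2 + n) * g 0 ∎

⊛-comm : ∀ (f g : Seq) → f ⊛ g ≗ g ⊛ f
⊛-comm f g zero    = *-comm (f 0) (g 0)
⊛-comm f g (suc n) = begin
  f 0 * g (suc n) + (f ∘ suc ⊛ g) n  ≡⟨ cong₂ _+_ (*-comm (f 0) _) (⊛-comm (f ∘ suc) g n) ⟩
  g (suc n) * f 0 + (g ⊛ f ∘ suc) n  ≡⟨ +-comm _ (((g ⊛ f ∘ suc) n)) ⟩
  (g ⊛ f ∘ suc) n + g (suc n) * f 0  ≡⟨ ⊛-suc-last g f n ⟨
  (g ⊛ f) (suc n)                    ∎

⊛-scaleˡ : ∀ c (f g : Seq) → (c · f) ⊛ g ≗ c · (f ⊛ g)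
⊛-scaleˡ c f g zero    = *-assoc c (f 0) (g 0)
⊛-scaleˡ c f g (suc n) = begin
  c * f 0 * g (suc n) + ((c · f ∘ suc) ⊛ g) n    ≡⟨ cong₂ _+_ (*-assoc c (f 0) _) (⊛-scaleˡ c (f ∘ suc) g n) ⟩
  c * (f 0 * g (suc n)) + c * (f ∘ suc ⊛ g) n    ≡⟨ *-distribˡ-+ c _ _ ⟨
  c * (f ⊛ g) (suc n)                            ∎

⊛-scaleʳ : ∀ c (f g : Seq) → f ⊛ (c · g) ≗ c · (f ⊛ g)
⊛-scaleʳ c f g n = begin
  (f ⊛ (c · g)) n  ≡⟨ ⊛-comm f (c · g) n ⟩
  ((c · g) ⊛ f) n  ≡⟨ ⊛-scaleˡ c g f n ⟩
  c * (g ⊛ f) n    ≡⟨ cong (c *_) (⊛-comm g f n) ⟩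
  c * (f ⊛ g) n    ∎

⊛-linearˡ : ∀ c (u v g : Seq) → (λ i → c * u i + v i) ⊛ g ≗ λ n → c * (u ⊛ g) n + (v ⊛ g) n
⊛-linearˡ c u v g zero    =
  trans (*-distribʳ-+ (g 0) (c * u 0) (v 0)) (cong (_+ v 0 * g 0) (*-assoc c (u 0) (g 0)))
⊛-linearˡ c u v g (suc n) =
  trans (cong ((c * u 0 + v 0) * g (suc n) +_) (⊛-linearˡ c (u ∘ suc) (v ∘ suc) g n))
        (regroup c (u 0) (v 0) (g (suc n)) _ _)
  where
  regroup : ∀ c a b x X Y → (c * a + b) * x + (c * X + Y) ≡ c * (a * x + X) + (b * x + Y)
  regroup = solve-∀

⊛-assoc : ∀ (f g h : Seq) → (f ⊛ g) ⊛ h ≗ f ⊛ (g ⊛ h)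
⊛-assoc f g h zero    = *-assoc (f 0) (g 0) (h 0)
⊛-assoc f g h (suc n) = begin
  f 0 * g 0 * h (suc n) + ((λ m → f 0 * g (suc m) + (f ∘ suc ⊛ g) m) ⊛ h) n
    ≡⟨ cong (f 0 * g 0 * h (suc n) +_) (⊛-linearˡ (f 0) (g ∘ suc) (f ∘ suc ⊛ g) h n) ⟩
  f 0 * g 0 * h (suc n) + (f 0 * (g ∘ suc ⊛ h) n + ((f ∘ suc ⊛ g) ⊛ h) n)
    ≡⟨ cong (λ z → f 0 * g 0 * h (suc n) + (f 0 * (g ∘ suc ⊛ h) n + z)) (⊛-assoc (f ∘ suc) g h n) ⟩
  f 0 * g 0 * h (suc n) + (f 0 * (g ∘ suc ⊛ h) n + (f ∘ suc ⊛ (g ⊛ h)) n)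
    ≡⟨ regroup (f 0) (g 0) (h (suc n)) _ _ ⟩
  f 0 * (g ⊛ h) (suc n) + (f ∘ suc ⊛ (g ⊛ h)) n ∎
  where
  regroup : ∀ a b x X Y → a * b * x + (a * X + Y) ≡ a * (b * x + X) + Y
  regroup = solve-∀

⊛-identityˡ : ∀ (g : Seq) → ε ⊛ g ≗ g
⊛-identityˡ g zero    = +-identityʳ (g 0)
⊛-identityˡ g (suc n) = begin
  1 * g (suc n) + (const 0 ⊛ g) n  ≡⟨ cong₂ _+_ (*-identityˡ _) (⊛-zeroˡ n) ⟩
  g (suc n) + 0                    ≡⟨ +-identityʳ _ ⟩
  g (suc n)                        ∎
  where
  ⊛-zeroˡ : const 0 ⊛ g ≗ const 0
  ⊛-zeroˡ zero    = refl
  ⊛-zeroˡ (suc n) = ⊛-zeroˡ n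

⊛-identityʳ : ∀ (f : Seq) → f ⊛ ε ≗ f
⊛-identityʳ f n = trans (⊛-comm f ε n) (⊛-identityˡ f n)

⊛-rearrange : ∀ (e o p q : Seq) → e ⊛ (o ⊛ (p ⊛ q)) ≗ (o ⊛ p) ⊛ (e ⊛ q)
⊛-rearrange e o p q n = begin
  (e ⊛ (o ⊛ (p ⊛ q))) n    ≡⟨ ⊛-congʳ e (λ m → ⊛-assoc o p q m) n ⟨
  (e ⊛ (o ⊛ p ⊛ q)) n      ≡⟨ ⊛-assoc e (o ⊛ p) q n ⟨
  (e ⊛ (o ⊛ p) ⊛ q) n      ≡⟨ ⊛-congˡ q (⊛-comm e (o ⊛ p)) n ⟩
  (o ⊛ p ⊛ e ⊛ q) n        ≡⟨ ⊛-assoc (o ⊛ p) e q n ⟩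
  (o ⊛ p ⊛ (e ⊛ q)) n      ∎

shift : ℕ → Seq → Seq
shift zero    f         = f
shift (suc k) f zero    = 0
shift (suc k) f (suc n) = shift k f n

shift-cong : ∀ k {f g : Seq} → f ≗ g → shift k f ≗ shift k g
shift-cong zero    f≗g n       = f≗g n
shift-cong (suc k) f≗g zero    = refl
shift-cong (suc k) f≗g (suc n) = shift-cong k f≗g n

shift-shift : ∀ j k (f : Seq) → shift j (shift k f) ≗ shift (j + k) f
shift-shift zero    k f n       = refl
shift-shift (suc j) k f zero    = refl
shift-shift (suc j) k f (suc n) = shift-shift j k f n

shift-· : ∀ k c (f : Seq) → shift k (c · f) ≗ c · shift k f
shift-· zero    c f n       = refl
shift-· (suc k) c f zero    = sym (*-zeroʳ c)
shift-· (suc k) c f (suc n) = shift-· k c f n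

shift-⊛ˡ : ∀ k (f g : Seq) → shift k f ⊛ g ≗ shift k (f ⊛ g)
shift-⊛ˡ zero    f g n       = refl
shift-⊛ˡ (suc k) f g zero    = refl
shift-⊛ˡ (suc k) f g (suc n) = shift-⊛ˡ k f g n

shift-⊛ʳ : ∀ k (f g : Seq) → f ⊛ shift k g ≗ shift k (f ⊛ g)
shift-⊛ʳ k f g n = begin
  (f ⊛ shift k g) n    ≡⟨ ⊛-comm f (shift k g) n ⟩
  (shift k g ⊛ f) n    ≡⟨ shift-⊛ˡ k g f n ⟩
  shift k (g ⊛ f) n    ≡⟨ shift-cong k (⊛-comm g f) n ⟩
  shift k (f ⊛ g) n    ∎

stretch : Seq → Seq
stretch f zero          = f 0
stretch f (suc zero)    = 0
stretch f (suc (suc n)) = stretch (f ∘ suc) n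

stretch-cong : ∀ {f g : Seq} → f ≗ g → stretch f ≗ stretch g
stretch-cong f≗g zero          = f≗g 0
stretch-cong f≗g (suc zero)    = refl
stretch-cong f≗g (suc (suc n)) = stretch-cong (f≗g ∘ suc) n

stretch-linear : ∀ c (u v : Seq) → stretch (λ m → c * u m + v m) ≗ λ n → c * stretch u n + stretch v n
stretch-linear c u v zero          = refl
stretch-linear c u v (suc zero)    = cong (_+ 0) (sym (*-zeroʳ c))
stretch-linear c u v (suc (suc n)) = stretch-linear c (u ∘ suc) (v ∘ suc) n

stretch-ε : stretch ε ≗ ε
stretch-ε zero          = refl
stretch-ε (suc zero)    = refl
stretch-ε (suc (suc n)) = stretch-0 n
  where
  stretch-0 : stretch (const 0) ≗ const 0
  stretch-0 zero          = refl
  stretch-0 (suc zero)    = refl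
  stretch-0 (suc (suc n)) = stretch-0 n

stretch-⊛ : ∀ (f g : Seq) → stretch f ⊛ stretch g ≗ stretch (f ⊛ g)
stretch-⊛ f g zero          = refl
stretch-⊛ f g (suc zero)    = cong (_+ 0) (*-zeroʳ (f 0))
stretch-⊛ f g (suc (suc n)) = begin
  f 0 * stretch (g ∘ suc) n + (0 * stretch g (suc n) + (stretch (f ∘ suc) ⊛ stretch g) n)
    ≡⟨ cong (f 0 * stretch (g ∘ suc) n +_) (stretch-⊛ (f ∘ suc) g n) ⟩
  f 0 * stretch (g ∘ suc) n + stretch (f ∘ suc ⊛ g) n
    ≡⟨ stretch-linear (f 0) (g ∘ suc) (f ∘ suc ⊛ g) n ⟨
  stretch (λ m → f 0 * g (suc m) + (f ∘ suc ⊛ g) m) n ∎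

infixr 8 _⊛^_

_⊛^_ : Seq → ℕ → Seq
f ⊛^ zero  = ε
f ⊛^ suc a = f ⊛ f ⊛^ a

geometric-⊛^ : ∀ a n → (geometric ⊛^ a) n ≡ (a + n ∸ 1) C n
geometric-⊛^ zero    zero    = refl
geometric-⊛^ zero    (suc n) = sym (k>n⇒nCk≡0 (n<1+n n))
geometric-⊛^ (suc a) zero    = trans (*-identityˡ _) (geometric-⊛^ a 0)
geometric-⊛^ (suc a) (suc n) = begin
  1 * (geometric ⊛^ a) (suc n) + (geometric ⊛ geometric ⊛^ a) n
    ≡⟨ cong₂ _+_ (*-identityˡ _) (geometric-⊛^ (suc a) n) ⟩
  (geometric ⊛^ a) (suc n) + (a + n) C n
    ≡⟨ cong (_+ (a + n) C n) (geometric-⊛^ a (suc n)) ⟩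
  (a + suc n ∸ 1) C suc n + (a + n) C n
    ≡⟨ cong (λ m → (m ∸ 1) C suc n + (a + n) C n) (+-suc a n) ⟩
  (a + n) C suc n + (a + n) C n
    ≡⟨ +-comm _ ((a + n) C n) ⟩
  (a + n) C n + (a + n) C suc n
    ≡⟨ nCk+nC[k+1]≡[n+1]C[k+1] (a + n) n ⟩
  suc (a + n) C suc n
    ≡⟨ cong (_C suc n) (+-suc a n) ⟨
  (a + suc n) C suc n ∎

⊛-as-∑ : ∀ (f g : Seq) {n N} → n < N → (f ⊛ g) n ≡ ∑[ r < N ] (f r * g (n ∸ r) when does (r ≤? n))
⊛-as-∑ f g {zero}  {suc N} _         =
  sym (trans (cong (f 0 * g 0 +_) (∑-zero N (λ _ → refl))) (+-identityʳ _))
⊛-as-∑ f g {suc n} {suc N} (s<s n<N) = cong (f 0 * g (suc n) +_) (begin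
  (f ∘ suc ⊛ g) n
    ≡⟨ ⊛-as-∑ (f ∘ suc) g n<N ⟩
  ∑[ r < N ] (f (suc r) * g (n ∸ r) when does (r ≤? n))
    ≡⟨ ∑-cong N (λ r → cong (f (suc r) * g (n ∸ r) when_) (<ᵇ-suc r n)) ⟨
  ∑[ r < N ] (f (suc r) * g (n ∸ r) when does (suc r ≤? suc n)) ∎)

stretch-as-∑ : ∀ (w : Seq) {j N} → j < N → ∑[ t < N ] (w t when does (2 * t ≟ j)) ≡ stretch w j
stretch-as-∑ w {zero}        {suc N} _ = trans (cong (w 0 +_) (∑-zero N (λ _ → refl))) (+-identityʳ _)
stretch-as-∑ w {suc zero}    {suc N} _ = ∑-zero N (λ t → cong (w (suc t) when_) (2*suc≟ t 1))
stretch-as-∑ w {suc (suc j)} {suc N} (s<s j<N) =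
  trans (∑-cong N (λ t → cong (w (suc t) when_) (2*suc≟ t (2 + j))))
        (stretch-as-∑ (w ∘ suc) (<-trans (n<1+n j) j<N))

∑-stretch-when : ∀ (w : Seq) r {n N} → n < N →
  ∑[ t < N ] (w t when does (r + 2 * t + 0 ≟ n)) ≡ stretch w (n ∸ r) when does (r ≤? n)
∑-stretch-when w zero    {n} {N} n<N =
  trans (∑-cong N (λ t → cong (λ m → w t when does (m ≟ n)) (+-identityʳ (2 * t)))) (stretch-as-∑ w n<N)
∑-stretch-when w (suc r) {zero}  {N} n<N = ∑-zero N (λ _ → refl)
∑-stretch-when w (suc r) {suc n} n<N =
  trans (∑-stretch-when w r (<-trans (n<1+n n) n<N)) (cong (stretch w (n ∸ r) when_) (sym (<ᵇ-suc r n)))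

∑∑-r+2t+k≡n : ∀ c (u v : Seq) k {n N} → n < N →
  ∑[ r < N ] ∑[ t < N ] (c * u r * v t when does (r + 2 * t + k ≟ n)) ≡ shift k (c · (u ⊛ stretch v)) n
∑∑-r+2t+k≡n c u v (suc k) {zero}  {N} _ =
  ∑-zero N (λ r → ∑-zero N (λ t → cong (λ m → c * u r * v t when does (m ≟ 0)) (+-suc (r + 2 * t) k)))
∑∑-r+2t+k≡n c u v (suc k) {suc n} {N} n<N = trans
  (∑-cong N (λ r → ∑-cong N (λ t → cong (λ m → c * u r * v t when does (m ≟ suc n)) (+-suc (r + 2 * t) k))))
  (∑∑-r+2t+k≡n c u v k (<-trans (n<1+n n) n<N))
∑∑-r+2t+k≡n c u v zero {n} {N} n<N = begin
  ∑[ r < N ] ∑[ t < N ] (c * u r * v t when does (r + 2 * t + 0 ≟ n))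
    ≡⟨ ∑-cong N (λ r → ∑-cong N (λ t → *-when (c * u r) (v t) _)) ⟨
  ∑[ r < N ] ∑[ t < N ] (c * u r * (v t when does (r + 2 * t + 0 ≟ n)))
    ≡⟨ ∑-cong N (λ r → ∑-*ˡ N (c * u r) _) ⟩
  ∑[ r < N ] (c * u r * ∑[ t < N ] (v t when does (r + 2 * t + 0 ≟ n)))
    ≡⟨ ∑-cong N (λ r → cong (c * u r *_) (∑-stretch-when v r n<N)) ⟩
  ∑[ r < N ] (c * u r * (stretch v (n ∸ r) when does (r ≤? n)))
    ≡⟨ ∑-cong N (λ r → *-when (c * u r) _ _) ⟩
  ∑[ r < N ] (c * u r * stretch v (n ∸ r) when does (r ≤? n))
    ≡⟨ ⊛-as-∑ (c · u) (stretch v) n<N ⟨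
  ((c · u) ⊛ stretch v) n
    ≡⟨ ⊛-scaleˡ c u (stretch v) n ⟩
  c * (u ⊛ stretch v) n ∎

sumR2T-as-∑ : ∀ n k (F : ℕ → ℕ → ℕ) →
  sumR2T n k F ≡ ∑[ r < suc n ] ∑[ t < suc n ] (F r t when does (r + 2 * t + k ≟ n))
sumR2T-as-∑ n k F = begin
  sumR2T n k F
    ≡⟨ ∑ᴸ-filter P? (λ p → F (proj₁ p) (proj₂ p)) (cartesianProduct L L) ⟩
  ∑ᴸ (λ p → F (proj₁ p) (proj₂ p) when does (P? p)) (cartesianProduct L L)
    ≡⟨ ∑ᴸ-cartesianProduct _ L L ⟩
  ∑ᴸ (λ r → ∑ᴸ (λ t → F r t when does (r + 2 * t + k ≟ n)) L) L
    ≡⟨ ∑ᴸ-cong (λ r → ∑ᴸ-upTo _ (suc n)) L ⟩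
  ∑ᴸ (λ r → ∑[ t < suc n ] (F r t when does (r + 2 * t + k ≟ n))) L
    ≡⟨ ∑ᴸ-upTo _ (suc n) ⟩
  ∑[ r < suc n ] ∑[ t < suc n ] (F r t when does (r + 2 * t + k ≟ n)) ∎
  where
  L = upTo (suc n)
  P? = λ (p : ℕ × ℕ) → proj₁ p + 2 * proj₂ p + k ≟ n

sumR2T-as-coefficient : ∀ n k c (u v : Seq) →
  sumR2T n k (λ r t → c * u r * v t) ≡ shift k (c · (u ⊛ stretch v)) n
sumR2T-as-coefficient n k c u v =
  trans (sumR2T-as-∑ n k (λ r t → c * u r * v t)) (∑∑-r+2t+k≡n c u v k (n<1+n n))

-- Generating functions of anti-palindromic compositions

withOuterPair : Seq → Seq
withOuterPair h = 2 · shift 3 (stretch geometric ⊛ (geometric ⊛ h))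

withOuterPair-cong : ∀ {g h : Seq} → g ≗ h → withOuterPair g ≗ withOuterPair h
withOuterPair-cong g≗h n =
  cong (2 *_) (shift-cong 3 (⊛-congʳ (stretch geometric) (⊛-congʳ geometric g≗h)) n)

acSeries : ℕ → Seq
acSeries zero          = ε
acSeries (suc zero)    = shift 1 geometric
acSeries (suc (suc s)) = withOuterPair (acSeries s)

withOuterPair-closedForm : ∀ k c (p q : Seq) →
  withOuterPair (shift k (c · (p ⊛ stretch q))) ≗
  shift (3 + k) (2 * c · (geometric ⊛ p) ⊛ stretch (geometric ⊛ q))
withOuterPair-closedForm k c p q n = begin
  2 * shift 3 (stretch geometric ⊛ (geometric ⊛ shift k (c · Z))) n
    ≡⟨ cong (2 *_) (shift-cong 3 pull-out n) ⟩
  2 * shift 3 (shift k (c · W)) n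
    ≡⟨ cong (2 *_) (shift-shift 3 k (c · W) n) ⟩
  2 * shift (3 + k) (c · W) n
    ≡⟨ cong (2 *_) (shift-· (3 + k) c W n) ⟩
  2 * (c * shift (3 + k) W n)
    ≡⟨ *-assoc 2 c _ ⟨
  2 * c * shift (3 + k) W n
    ≡⟨ shift-· (3 + k) (2 * c) W n ⟨
  shift (3 + k) (2 * c · W) n
    ≡⟨ shift-cong (3 + k) (λ m → cong (2 * c *_) (regroup m)) n ⟩
  shift (3 + k) (2 * c · (geometric ⊛ p) ⊛ stretch (geometric ⊛ q)) n ∎
  where
  Z = p ⊛ stretch q
  W = stretch geometric ⊛ (geometric ⊛ Z)
  pull-out : stretch geometric ⊛ (geometric ⊛ shift k (c · Z)) ≗ shift k (c · W)
  pull-out m = begin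
    (stretch geometric ⊛ (geometric ⊛ shift k (c · Z))) m
      ≡⟨ ⊛-congʳ (stretch geometric) (shift-⊛ʳ k geometric (c · Z)) m ⟩
    (stretch geometric ⊛ shift k (geometric ⊛ (c · Z))) m
      ≡⟨ shift-⊛ʳ k (stretch geometric) _ m ⟩
    shift k (stretch geometric ⊛ (geometric ⊛ (c · Z))) m
      ≡⟨ shift-cong k (⊛-congʳ (stretch geometric) (⊛-scaleʳ c geometric Z)) m ⟩
    shift k (stretch geometric ⊛ (c · geometric ⊛ Z)) m
      ≡⟨ shift-cong k (⊛-scaleʳ c (stretch geometric) (geometric ⊛ Z)) m ⟩
    shift k (c · W) m ∎
  regroup : W ≗ (geometric ⊛ p) ⊛ stretch (geometric ⊛ q)
  regroup m = trans (⊛-rearrange (stretch geometric) geometric p (stretch q) m)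
                    (⊛-congʳ (geometric ⊛ p) (stretch-⊛ geometric q) m)

acSeries-even : ∀ a → acSeries (2 * a) ≗ shift (3 * a) (2 ^ a · (geometric ⊛^ a) ⊛ stretch (geometric ⊛^ a))
acSeries-even zero    n = sym (begin
  1 * (ε ⊛ stretch ε) n    ≡⟨ *-identityˡ _ ⟩
  (ε ⊛ stretch ε) n        ≡⟨ ⊛-identityˡ (stretch ε) n ⟩
  stretch ε n              ≡⟨ stretch-ε n ⟩
  ε n                      ∎)
acSeries-even (suc a) n = begin
  acSeries (2 * suc a) n
    ≡⟨ cong (λ s → acSeries s n) (*-suc 2 a) ⟩
  withOuterPair (acSeries (2 * a)) n
    ≡⟨ withOuterPair-cong (acSeries-even a) n ⟩
  withOuterPair (shift (3 * a) (2 ^ a · (geometric ⊛^ a) ⊛ stretch (geometric ⊛^ a))) n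
    ≡⟨ withOuterPair-closedForm (3 * a) (2 ^ a) (geometric ⊛^ a) (geometric ⊛^ a) n ⟩
  shift (3 + 3 * a) (2 ^ suc a · (geometric ⊛^ suc a) ⊛ stretch (geometric ⊛^ suc a)) n
    ≡⟨ cong (λ k → shift k F n) (*-suc 3 a) ⟨
  shift (3 * suc a) (2 ^ suc a · (geometric ⊛^ suc a) ⊛ stretch (geometric ⊛^ suc a)) n ∎
  where
  F = 2 ^ suc a · (geometric ⊛^ suc a) ⊛ stretch (geometric ⊛^ suc a)

acSeries-odd : ∀ a →
  acSeries (2 * a + 1) ≗ shift (3 * a + 1) (2 ^ a · (geometric ⊛^ suc a) ⊛ stretch (geometric ⊛^ a))
acSeries-odd zero    zero    = refl
acSeries-odd zero    (suc n) = sym (begin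
  1 * ((geometric ⊛ ε) ⊛ stretch ε) n    ≡⟨ *-identityˡ _ ⟩
  ((geometric ⊛ ε) ⊛ stretch ε) n        ≡⟨ ⊛-congʳ (geometric ⊛ ε) stretch-ε n ⟩
  ((geometric ⊛ ε) ⊛ ε) n                ≡⟨ ⊛-identityʳ _ n ⟩
  (geometric ⊛ ε) n                      ≡⟨ ⊛-identityʳ geometric n ⟩
  1                                      ∎)
acSeries-odd (suc a) n = begin
  acSeries (2 * suc a + 1) n
    ≡⟨ cong (λ s → acSeries (s + 1) n) (*-suc 2 a) ⟩
  withOuterPair (acSeries (2 * a + 1)) n
    ≡⟨ withOuterPair-cong (acSeries-odd a) n ⟩
  withOuterPair (shift (3 * a + 1) (2 ^ a · (geometric ⊛^ suc a) ⊛ stretch (geometric ⊛^ a))) n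
    ≡⟨ withOuterPair-closedForm (3 * a + 1) (2 ^ a) (geometric ⊛^ suc a) (geometric ⊛^ a) n ⟩
  shift (3 + (3 * a + 1)) (2 ^ suc a · (geometric ⊛^ suc (suc a)) ⊛ stretch (geometric ⊛^ suc a)) n
    ≡⟨ cong (λ k → shift k F n) (trans (sym (+-assoc 3 (3 * a) 1)) (cong (_+ 1) (sym (*-suc 3 a)))) ⟩
  shift (3 * suc a + 1) (2 ^ suc a · (geometric ⊛^ suc (suc a)) ⊛ stretch (geometric ⊛^ suc a)) n ∎
  where
  F = 2 ^ suc a · (geometric ⊛^ suc (suc a)) ⊛ stretch (geometric ⊛^ suc a)

-- Ordered pairs of distinct outer entries

OuterPair : ℕ → ℕ → ℕ → Set
OuterPair m x y = 0 < x × 0 < y × x ≢ y × x + y ≤ m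

outerPair? : ∀ m x y → Dec (OuterPair m x y)
outerPair? m x y = 0 <? x ×-dec 0 <? y ×-dec ¬? (x ≟ y) ×-dec x + y ≤? m

IncreasingPair : ℕ → ℕ → ℕ → Set
IncreasingPair m x y = 0 < x × x < y × x + y ≤ m

increasingPair? : ∀ m x y → Dec (IncreasingPair m x y)
increasingPair? m x y = 0 <? x ×-dec x <? y ×-dec x + y ≤? m

outerPair-split : ∀ (h : Seq) m x y →
  h (m ∸ x ∸ y) when does (outerPair? m x y) ≡
  h (m ∸ x ∸ y) when does (increasingPair? m x y) + h (m ∸ y ∸ x) when does (increasingPair? m y x)
outerPair-split h m x y with <-cmp x y
... | tri< x<y _ _
  rewrite does-⇔ (mk⇔ (λ (0<x , _ , _ , x+y≤m) → 0<x , x<y , x+y≤m)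
                      (λ (0<x , _ , x+y≤m) → 0<x , <-≤-trans 0<x (<⇒≤ x<y) , <⇒≢ x<y , x+y≤m))
                 (outerPair? m x y) (increasingPair? m x y)
        | dec-false (increasingPair? m y x) (λ (_ , y<x , _) → <-asym x<y y<x)
        = sym (+-identityʳ _)
... | tri≈ _ refl _
  rewrite dec-false (outerPair? m x x) (λ (_ , _ , x≢x , _) → x≢x refl)
        | dec-false (increasingPair? m x x) (λ (_ , x<x , _) → <-irrefl refl x<x)
        = refl
... | tri> _ _ y<x
  rewrite does-⇔ (mk⇔ (λ (_ , 0<y , _ , x+y≤m) → 0<y , y<x , subst (_≤ m) (+-comm x y) x+y≤m)
                      (λ (0<y , _ , y+x≤m) → <-≤-trans 0<y (<⇒≤ y<x) , 0<y , ≢-sym (<⇒≢ y<x) ,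
                                              subst (_≤ m) (+-comm y x) y+x≤m))
                 (outerPair? m x y) (increasingPair? m y x)
        | dec-false (increasingPair? m x y) (λ (_ , x<y , _) → <-asym x<y y<x)
        = cong (_when does (increasingPair? m y x)) (cong h (∸-comm m x y))
  where
  ∸-comm : ∀ m x y → m ∸ x ∸ y ≡ m ∸ y ∸ x
  ∸-comm m x y = begin
    m ∸ x ∸ y    ≡⟨ ∸-+-assoc m x y ⟩
    m ∸ (x + y)  ≡⟨ cong (m ∸_) (+-comm x y) ⟩
    m ∸ (y + x)  ≡⟨ ∸-+-assoc m y x ⟨
    m ∸ y ∸ x    ∎

∑-geometric-tail : ∀ (g : Seq) c {M N} → M < N →
  ∑[ y < N ] (g (M ∸ y) when does (c <? y ×-dec y ≤? M)) ≡ shift 1 (geometric ⊛ g) (M ∸ c)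
∑-geometric-tail g zero    {zero}  {suc N} _ = ∑-zero N (λ { zero → refl ; (suc y) → refl })
∑-geometric-tail g zero    {suc M} {suc N} (s<s M<N) = begin
  ∑[ y < N ] (g (M ∸ y) when does (suc y ≤? suc M))
    ≡⟨ ∑-cong N (λ y → cong (g (M ∸ y) when_) (<ᵇ-suc y M)) ⟩
  ∑[ y < N ] (g (M ∸ y) when does (y ≤? M))
    ≡⟨ ∑-cong N (λ y → cong (_when does (y ≤? M)) (*-identityˡ (g (M ∸ y)))) ⟨
  ∑[ y < N ] (1 * g (M ∸ y) when does (y ≤? M))
    ≡⟨ ⊛-as-∑ geometric g M<N ⟨
  (geometric ⊛ g) M ∎
∑-geometric-tail g (suc c) {zero}  {suc N} _ =
  ∑-zero N (λ y → cong (g 0 when_) (∧-zeroʳ (does (c <? y))))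
∑-geometric-tail g (suc c) {suc M} {suc N} (s<s M<N) =
  trans (∑-cong N (λ y → cong (λ b → g (M ∸ y) when (does (c <? y) ∧ b)) (<ᵇ-suc y M)))
        (∑-geometric-tail g c M<N)

∑-increasingPair : ∀ (h : Seq) m x {N} → m < N →
  ∑[ y < N ] (h (m ∸ x ∸ y) when does (increasingPair? m x y)) ≡
  shift 1 (geometric ⊛ h) (m ∸ x ∸ x) when does (0 <? x)
∑-increasingPair h m zero    {N} _   = ∑-zero N (λ _ → refl)
∑-increasingPair h m (suc x) {N} m<N =
  trans (∑-cong N (λ y → cong (h (m ∸ suc x ∸ y) when_)
                              (does-⇔ (mk⇔ to from) (increasingPair? m (suc x) y) (suc x <? y ×-dec y ≤? m ∸ suc x))))
        (∑-geometric-tail h (suc x) (≤-<-trans (m∸n≤m m (suc x)) m<N))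
  where
  to : ∀ {y} → IncreasingPair m (suc x) y → suc x < y × y ≤ m ∸ suc x
  to {y} (_ , x<y , x+y≤m) = x<y , m+n≤o⇒m≤o∸n y (subst (_≤ m) (+-comm (suc x) y) x+y≤m)
  from : ∀ {y} → suc x < y × y ≤ m ∸ suc x → IncreasingPair m (suc x) y
  from {y} (x<y , y≤m∸x) = z<s , x<y , subst (_≤ m) (+-comm y (suc x)) (m≤o∸n⇒m+n≤o y x≤m y≤m∸x)
    where
    x≤m : suc x ≤ m
    x≤m = <⇒≤ (m∸n≢0⇒n<m (≢-sym (<⇒≢ (<-≤-trans (<-trans z<s x<y) y≤m∸x))))

∑-stretch-geometric : ∀ (K : Seq) {n N} → n < N →
  ∑[ x < N ] (K (n ∸ 2 * x) when does (2 * x ≤? n)) ≡ (stretch geometric ⊛ K) n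
∑-stretch-geometric K {zero}        {suc N} _ =
  cong (K 0 +_) (∑-zero N (λ _ → refl))
∑-stretch-geometric K {suc zero}    {suc N} _ = trans
  (cong (K 1 +_) (∑-zero N (λ x → cong (λ k → K (1 ∸ k) when does (k ≤? 1)) (*-suc 2 x))))
  (sym (+-identityʳ (K 1 + 0)))
∑-stretch-geometric K {suc (suc n)} {suc N} (s<s n<N) = cong₂ _+_
  (sym (+-identityʳ (K (2 + n))))
  (trans (∑-cong N drop-two) (∑-stretch-geometric K (<-trans (n<1+n n) n<N)))
  where
  drop-two : ∀ x → K (2 + n ∸ 2 * suc x) when does (2 * suc x ≤? 2 + n) ≡ K (n ∸ 2 * x) when does (2 * x ≤? n)
  drop-two x = trans (cong (λ k → K (2 + n ∸ k) when does (k ≤? 2 + n)) (*-suc 2 x))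
                     (cong (K (n ∸ 2 * x) when_) (<ᵇ-suc (2 * x) n))

shift1-∸ : ∀ (K : Seq) m j → shift 1 K (suc m ∸ j) ≡ K (m ∸ j) when does (j ≤? m)
shift1-∸ K m       zero    = refl
shift1-∸ K zero    (suc j) = cong (shift 1 K) (0∸n≡0 j)
shift1-∸ K (suc m) (suc j) = trans (shift1-∸ K m j) (cong (K (m ∸ j) when_) (sym (<ᵇ-suc j m)))

∑-shift1-∸2x : ∀ (K : Seq) {m B} → m ≤ B →
  ∑[ x < suc B ] (shift 1 K (m ∸ x ∸ x) when does (0 <? x)) ≡ shift 3 (stretch geometric ⊛ K) m
∑-shift1-∸2x K {0}           {B} _ = ∑-zero B (λ _ → refl)
∑-shift1-∸2x K {1}           {B} _ = ∑-zero B (λ { zero → refl ; (suc x) → refl })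
∑-shift1-∸2x K {2}           {B} _ = ∑-zero B (λ { zero → refl ; (suc zero) → refl ; (suc (suc x)) → refl })
∑-shift1-∸2x K {suc (suc (suc m))} {B} m≤B = begin
  ∑[ x < B ] shift 1 K (3 + m ∸ suc x ∸ suc x)
    ≡⟨ ∑-cong B (λ x → cong (shift 1 K) (halve x)) ⟩
  ∑[ x < B ] shift 1 K (suc m ∸ 2 * x)
    ≡⟨ ∑-cong B (λ x → shift1-∸ K m (2 * x)) ⟩
  ∑[ x < B ] (K (m ∸ 2 * x) when does (2 * x ≤? m))
    ≡⟨ ∑-stretch-geometric K (≤-trans (n≤1+n _) (≤-trans (n≤1+n _) m≤B)) ⟩
  (stretch geometric ⊛ K) m ∎
  where
  x+1+x≡1+2x : ∀ x → x + suc x ≡ suc (2 * x)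
  x+1+x≡1+2x = solve-∀
  halve : ∀ x → 3 + m ∸ suc x ∸ suc x ≡ suc m ∸ 2 * x
  halve x = begin
    2 + m ∸ x ∸ suc x      ≡⟨ ∸-+-assoc (2 + m) x (suc x) ⟩
    2 + m ∸ (x + suc x)    ≡⟨ cong (2 + m ∸_) (x+1+x≡1+2x x) ⟩
    2 + m ∸ suc (2 * x)    ∎

∑∑-outerPair : ∀ (h : Seq) {m B} → m ≤ B →
  ∑[ x < suc B ] ∑[ y < suc B ] (h (m ∸ x ∸ y) when does (outerPair? m x y)) ≡ withOuterPair h m
-- The pairs with y < x contribute as much as those with x < y.
∑∑-outerPair h {m} {B} m≤B = begin
  ∑[ x < N ] ∑[ y < N ] (h (m ∸ x ∸ y) when does (outerPair? m x y))
    ≡⟨ ∑-cong N (λ x → trans (∑-cong N (outerPair-split h m x)) (∑-+ N (I x) (λ y → I y x))) ⟩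
  ∑[ x < N ] (∑< N (I x) + ∑[ y < N ] I y x)
    ≡⟨ ∑-+ N (λ x → ∑< N (I x)) (λ x → ∑[ y < N ] I y x) ⟩
  X + ∑[ x < N ] ∑[ y < N ] I y x
    ≡⟨ cong (X +_) (∑-comm N N (λ x y → I y x)) ⟩
  X + X
    ≡⟨ cong (λ z → z + z) X≡Y ⟩
  Y + Y
    ≡⟨ cong (Y +_) (+-identityʳ Y) ⟨
  2 * Y ∎
  where
  N = suc B
  I : ℕ → ℕ → ℕ
  I x y = h (m ∸ x ∸ y) when does (increasingPair? m x y)
  X = ∑[ x < N ] ∑< N (I x)
  Y = shift 3 (stretch geometric ⊛ (geometric ⊛ h)) m
  X≡Y : X ≡ Y
  X≡Y = trans (∑-cong N (λ x → ∑-increasingPair h m x (s≤s m≤B))) (∑-shift1-∸2x (geometric ⊛ h) m≤B)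

-- Peeling off the outer entries of a composition

∑ᴸ-vecsUpTo-∷ : ∀ B s (F : Vec ℕ (suc s) → ℕ) →
  ∑ᴸ F (vecsUpTo B (suc s)) ≡ ∑[ x < suc B ] ∑ᴸ (F ∘ (x ∷_)) (vecsUpTo B s)
∑ᴸ-vecsUpTo-∷ B s F = begin
  ∑ᴸ F (concatMap (λ x → map (x ∷_) (vecsUpTo B s)) (upTo (suc B)))
    ≡⟨ ∑ᴸ-concatMap F (λ x → map (x ∷_) (vecsUpTo B s)) (upTo (suc B)) ⟩
  ∑ᴸ (λ x → ∑ᴸ F (map (x ∷_) (vecsUpTo B s))) (upTo (suc B))
    ≡⟨ ∑ᴸ-cong (λ x → ∑ᴸ-map F (x ∷_) (vecsUpTo B s)) (upTo (suc B)) ⟩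
  ∑ᴸ (λ x → ∑ᴸ (F ∘ (x ∷_)) (vecsUpTo B s)) (upTo (suc B))
    ≡⟨ ∑ᴸ-upTo _ (suc B) ⟩
  ∑[ x < suc B ] ∑ᴸ (F ∘ (x ∷_)) (vecsUpTo B s) ∎

∑ᴸ-vecsUpTo-∷ʳ : ∀ B s (F : Vec ℕ (suc s) → ℕ) →
  ∑ᴸ F (vecsUpTo B (suc s)) ≡ ∑ᴸ (λ w → ∑[ y < suc B ] F (w ∷ʳ y)) (vecsUpTo B s)
∑ᴸ-vecsUpTo-∷ʳ B zero    F =
  trans (∑ᴸ-vecsUpTo-∷ B zero F) (trans (∑-cong (suc B) (λ x → +-identityʳ (F (x ∷ [])))) (sym (+-identityʳ _)))
∑ᴸ-vecsUpTo-∷ʳ B (suc s) F = begin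
  ∑ᴸ F (vecsUpTo B (2 + s))
    ≡⟨ ∑ᴸ-vecsUpTo-∷ B (suc s) F ⟩
  ∑[ x < suc B ] ∑ᴸ (F ∘ (x ∷_)) (vecsUpTo B (suc s))
    ≡⟨ ∑-cong (suc B) (λ x → ∑ᴸ-vecsUpTo-∷ʳ B s (F ∘ (x ∷_))) ⟩
  ∑[ x < suc B ] ∑ᴸ (λ w → ∑[ y < suc B ] F (x ∷ (w ∷ʳ y))) (vecsUpTo B s)
    ≡⟨ ∑ᴸ-vecsUpTo-∷ B s (λ w → ∑[ y < suc B ] F (w ∷ʳ y)) ⟨
  ∑ᴸ (λ w → ∑[ y < suc B ] F (w ∷ʳ y)) (vecsUpTo B (suc s)) ∎

∑ᴸ-vecsUpTo-outer : ∀ B s (F : Vec ℕ (2 + s) → ℕ) →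
  ∑ᴸ F (vecsUpTo B (2 + s)) ≡ ∑[ x < suc B ] ∑[ y < suc B ] ∑ᴸ (λ w → F (x ∷ (w ∷ʳ y))) (vecsUpTo B s)
∑ᴸ-vecsUpTo-outer B s F =
  trans (∑ᴸ-vecsUpTo-∷ B (suc s) F)
        (∑-cong (suc B) (λ x → trans (∑ᴸ-vecsUpTo-∷ʳ B s (F ∘ (x ∷_)))
                                      (∑ᴸ-∑ (suc B) (λ w y → F (x ∷ (w ∷ʳ y))) (vecsUpTo B s))))

module _ {A : Set} where

  All-∷ʳ⁻ : ∀ {P : A → Set} {s} (w : Vec A s) y → All P (w ∷ʳ y) → All P w × P y
  All-∷ʳ⁻ []      y (py ∷ [])   = [] , py
  All-∷ʳ⁻ (a ∷ w) y (pa ∷ pwy) = let (pw , py) = All-∷ʳ⁻ w y pwy in pa ∷ pw , py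

  All-∷ʳ⁺ : ∀ {P : A → Set} {s} (w : Vec A s) y → All P w → P y → All P (w ∷ʳ y)
  All-∷ʳ⁺ []      y []         py = py ∷ []
  All-∷ʳ⁺ (a ∷ w) y (pa ∷ pw) py = pa ∷ All-∷ʳ⁺ w y pw py

  lookup-∷ʳ-fromℕ : ∀ {s} (w : Vec A s) y → lookup (w ∷ʳ y) (fromℕ s) ≡ y
  lookup-∷ʳ-fromℕ []      y = refl
  lookup-∷ʳ-fromℕ (a ∷ w) y = lookup-∷ʳ-fromℕ w y

  lookup-∷ʳ-inject₁ : ∀ {s} (w : Vec A s) y (k : Fin s) → lookup (w ∷ʳ y) (inject₁ k) ≡ lookup w k
  lookup-∷ʳ-inject₁ (a ∷ w) y zero    = refl
  lookup-∷ʳ-inject₁ (a ∷ w) y (suc k) = lookup-∷ʳ-inject₁ w y k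

sum-∷ʳ : ∀ {s} (w : Vec ℕ s) y → Vec.sum (w ∷ʳ y) ≡ Vec.sum w + y
sum-∷ʳ []      y = +-identityʳ y
sum-∷ʳ (a ∷ w) y = trans (cong (a +_) (sum-∷ʳ w y)) (sym (+-assoc a _ y))

opposite-fromℕ : ∀ n → opposite (fromℕ n) ≡ zero
opposite-fromℕ zero    = refl
opposite-fromℕ (suc n) = cong inject₁ (opposite-fromℕ n)

opposite-inject₁ : ∀ {n} (k : Fin n) → opposite (inject₁ k) ≡ suc (opposite k)
opposite-inject₁ {suc n} zero    = refl
opposite-inject₁ {suc n} (suc k) = cong inject₁ (opposite-inject₁ k)

x+[t+y]≡m⇒x+y≤m×t≡m∸x∸y : ∀ x y {t m} → x + (t + y) ≡ m → x + y ≤ m × t ≡ m ∸ x ∸ y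
x+[t+y]≡m⇒x+y≤m×t≡m∸x∸y x y {t} {m} e = subst (x + y ≤_) e′ (m≤m+n (x + y) t) , (begin
  t                    ≡⟨ m+n∸m≡n (x + y) t ⟨
  x + y + t ∸ (x + y)  ≡⟨ cong (_∸ (x + y)) e′ ⟩
  m ∸ (x + y)          ≡⟨ ∸-+-assoc m x y ⟨
  m ∸ x ∸ y            ∎)
  where
  e′ : x + y + t ≡ m
  e′ = trans (regroup x y t) e
    where
    regroup : ∀ x y t → x + y + t ≡ x + (t + y)
    regroup = solve-∀

x+y≤m⇒x+[[m∸x∸y]+y]≡m : ∀ x y {m} → x + y ≤ m → x + ((m ∸ x ∸ y) + y) ≡ m
x+y≤m⇒x+[[m∸x∸y]+y]≡m x y {m} x+y≤m = begin
  x + ((m ∸ x ∸ y) + y)    ≡⟨ regroup x y (m ∸ x ∸ y) ⟩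
  x + y + (m ∸ x ∸ y)      ≡⟨ cong (x + y +_) (∸-+-assoc m x y) ⟩
  x + y + (m ∸ (x + y))    ≡⟨ m+[n∸m]≡n x+y≤m ⟩
  m                        ∎
  where
  regroup : ∀ x y t → x + (t + y) ≡ x + y + t
  regroup = solve-∀

2[1+t]+1≡2+[2t+1] : ∀ t → 2 * suc t + 1 ≡ 2 + (2 * t + 1)
2[1+t]+1≡2+[2t+1] = solve-∀

APComposition : ℕ → (s : ℕ) → Vec ℕ s → Set
APComposition m s σ = IsComposition m s σ × IsAntiPalindromic s σ

apComposition? : ∀ m s σ → Dec (APComposition m s σ)
apComposition? m s σ = isComposition? m s σ ×-dec isAntiPalindromic? s σ

module _ (x y : ℕ) {s : ℕ} (w : Vec ℕ s) where

  private
    σ : Vec ℕ (2 + s)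
    σ = x ∷ (w ∷ʳ y)

    lookup-inner : ∀ k → lookup σ (suc (inject₁ k)) ≡ lookup w k
    lookup-inner = lookup-∷ʳ-inject₁ w y

    lookup-inner-opposite : ∀ k → lookup σ (opposite (suc (inject₁ k))) ≡ lookup w (opposite k)
    lookup-inner-opposite k =
      trans (cong (λ i → lookup σ (inject₁ i)) (opposite-inject₁ k)) (lookup-∷ʳ-inject₁ w y (opposite k))

    centre-inner : ∀ (k : Fin s) → 2 * toℕ (suc (inject₁ k)) + 1 ≡ 2 + (2 * toℕ k + 1)
    centre-inner k = trans (cong (λ t → 2 * suc t + 1) (toℕ-inject₁ k)) (2[1+t]+1≡2+[2t+1] (toℕ k))

  isComposition-outer⁻ : ∀ {m} → IsComposition m (2 + s) σ →
    0 < x × 0 < y × x + y ≤ m × IsComposition (m ∸ x ∸ y) s w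
  isComposition-outer⁻ (0<x ∷ positive , e) =
    let (positive-w , 0<y) = All-∷ʳ⁻ w y positive
        (x+y≤m , sum≡) = x+[t+y]≡m⇒x+y≤m×t≡m∸x∸y x y (trans (cong (x +_) (sym (sum-∷ʳ w y))) e)
    in 0<x , 0<y , x+y≤m , positive-w , sum≡

  isComposition-outer⁺ : ∀ {m} → 0 < x → 0 < y → x + y ≤ m → IsComposition (m ∸ x ∸ y) s w →
    IsComposition m (2 + s) σ
  isComposition-outer⁺ 0<x 0<y x+y≤m (positive-w , sum≡) =
    0<x ∷ All-∷ʳ⁺ w y positive-w 0<y ,
    trans (cong (x +_) (sum-∷ʳ w y))
          (trans (cong (λ t → x + (t + y)) sum≡) (x+y≤m⇒x+[[m∸x∸y]+y]≡m x y x+y≤m))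

  isAntiPalindromic-outer⁻ : IsAntiPalindromic (2 + s) σ → x ≢ y × IsAntiPalindromic s w
  isAntiPalindromic-outer⁻ ap =
    (λ x≡y → ap zero (λ ()) (trans x≡y (sym (lookup-∷ʳ-fromℕ w y)))) ,
    (λ k ne e → ap (suc (inject₁ k)) (λ e′ → ne (suc-injective (suc-injective (trans (sym (centre-inner k)) e′))))
                   (trans (lookup-inner k) (trans e (sym (lookup-inner-opposite k)))))

  isAntiPalindromic-outer⁺ : x ≢ y → IsAntiPalindromic s w → IsAntiPalindromic (2 + s) σ
  isAntiPalindromic-outer⁺ x≢y ap-w zero    _  e = x≢y (trans e (lookup-∷ʳ-fromℕ w y))
  isAntiPalindromic-outer⁺ x≢y ap-w (suc j) ne e with view j
  ... | ‵fromℕ     = x≢y (sym (begin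
    y                                       ≡⟨ lookup-∷ʳ-fromℕ w y ⟨
    lookup σ (suc (fromℕ s))                ≡⟨ e ⟩
    lookup σ (inject₁ (opposite (fromℕ s))) ≡⟨ cong (λ i → lookup σ (inject₁ i)) (opposite-fromℕ s) ⟩
    x                                       ∎))
  ... | ‵inject₁ k = ap-w k (λ e′ → ne (trans (centre-inner k) (cong (2 +_) e′))) (trans (sym (lookup-inner k)) (trans e (lookup-inner-opposite k)))

  apComposition-outer : ∀ {m} → APComposition m (2 + s) σ ⇔ (OuterPair m x y × APComposition (m ∸ x ∸ y) s w)
  apComposition-outer = mk⇔
    (λ (c , a) → let (0<x , 0<y , x+y≤m , c′) = isComposition-outer⁻ c
                     (x≢y , a′) = isAntiPalindromic-outer⁻ a
                 in (0<x , 0<y , x≢y , x+y≤m) , c′ , a′)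
    (λ ((0<x , 0<y , x≢y , x+y≤m) , c′ , a′) →
      isComposition-outer⁺ 0<x 0<y x+y≤m c′ , isAntiPalindromic-outer⁺ x≢y a′)

-- ac n s = acUpTo n n s; the bound B on the entries stays fixed while peeling off outer
-- entries decreases m, so the two have to be separated.
acUpTo : ℕ → ℕ → ℕ → ℕ
acUpTo B m s = length (filter (apComposition? m s) (vecsUpTo B s))

acUpTo-outer : ∀ B m s →
  acUpTo B m (2 + s) ≡ ∑[ x < suc B ] ∑[ y < suc B ] (acUpTo B (m ∸ x ∸ y) s when does (outerPair? m x y))
acUpTo-outer B m s = begin
  acUpTo B m (2 + s)
    ≡⟨ length-filter (apComposition? m (2 + s)) (vecsUpTo B (2 + s)) ⟩
  ∑ᴸ (λ σ → 1 when does (apComposition? m (2 + s) σ)) (vecsUpTo B (2 + s))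
    ≡⟨ ∑ᴸ-vecsUpTo-outer B s _ ⟩
  ∑[ x < suc B ] ∑[ y < suc B ] ∑ᴸ (λ w → 1 when does (apComposition? m (2 + s) (x ∷ (w ∷ʳ y)))) V
    ≡⟨ ∑-cong (suc B) (λ x → ∑-cong (suc B) (inner x)) ⟩
  ∑[ x < suc B ] ∑[ y < suc B ] (acUpTo B (m ∸ x ∸ y) s when does (outerPair? m x y)) ∎
  where
  V = vecsUpTo B s
  inner : ∀ x y → ∑ᴸ (λ w → 1 when does (apComposition? m (2 + s) (x ∷ (w ∷ʳ y)))) V ≡
                  acUpTo B (m ∸ x ∸ y) s when does (outerPair? m x y)
  inner x y = begin
    ∑ᴸ (λ w → 1 when does (apComposition? m (2 + s) (x ∷ (w ∷ʳ y)))) V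
      ≡⟨ ∑ᴸ-cong (λ w → cong (1 when_) (does-⇔ (apComposition-outer x y w)
                                               (apComposition? m (2 + s) (x ∷ (w ∷ʳ y)))
                                               (outerPair? m x y ×-dec apComposition? (m ∸ x ∸ y) s w))) V ⟩
    ∑ᴸ (λ w → 1 when (does (outerPair? m x y) ∧ does (apComposition? (m ∸ x ∸ y) s w))) V
      ≡⟨ ∑ᴸ-cong (λ w → when-∧ 1 (does (outerPair? m x y)) _) V ⟩
    ∑ᴸ (λ w → 1 when does (apComposition? (m ∸ x ∸ y) s w) when does (outerPair? m x y)) V
      ≡⟨ ∑ᴸ-when _ _ V ⟩
    ∑ᴸ (λ w → 1 when does (apComposition? (m ∸ x ∸ y) s w)) V when does (outerPair? m x y)
      ≡⟨ cong (_when does (outerPair? m x y)) (length-filter (apComposition? (m ∸ x ∸ y) s) V) ⟨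
    acUpTo B (m ∸ x ∸ y) s when does (outerPair? m x y) ∎

apComposition-singleton : ∀ m x → APComposition m 1 (x ∷ []) ⇔ (0 < x × x ≡ m)
apComposition-singleton m x = mk⇔
  (λ { ((0<x ∷ [] , sum≡m) , _) → 0<x , trans (sym (+-identityʳ x)) sum≡m })
  (λ { (0<x , refl) → (0<x ∷ [] , +-identityʳ x) , λ { zero ne _ → ne refl } })

acUpTo≡acSeries : ∀ s {B m} → m ≤ B → acUpTo B m s ≡ acSeries s m
acUpTo≡acSeries zero {m = zero}  _ = cong (λ b → 1 when b + 0) (dec-true (apComposition? 0 0 []) (([] , refl) , λ ()))
acUpTo≡acSeries zero {m = suc m} _ = cong (λ b → 1 when b + 0) (dec-false (apComposition? (suc m) 0 []) (λ ((_ , 0≡1+m) , _) → 0≢1+n 0≡1+m))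
acUpTo≡acSeries (suc zero) {B} {m} m≤B = begin
  acUpTo B m 1
    ≡⟨ length-filter (apComposition? m 1) (vecsUpTo B 1) ⟩
  ∑ᴸ (λ σ → 1 when does (apComposition? m 1 σ)) (vecsUpTo B 1)
    ≡⟨ ∑ᴸ-vecsUpTo-∷ B 0 (λ σ → 1 when does (apComposition? m 1 σ)) ⟩
  ∑[ x < suc B ] (1 when does (apComposition? m 1 (x ∷ [])) + 0)
    ≡⟨ ∑-cong (suc B) (λ x → trans (+-identityʳ _) (cong (1 when_)
         (does-⇔ (apComposition-singleton m x) (apComposition? m 1 (x ∷ [])) (0 <? x ×-dec x ≟ m)))) ⟩
  ∑[ x < suc B ] (1 when does (0 <? x ×-dec x ≟ m))
    ≡⟨ singleton-count m m≤B ⟩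
  shift 1 geometric m ∎
  where
  is-positive-and : ℕ → ℕ → ℕ
  is-positive-and m x = 1 when does (0 <? x ×-dec x ≟ m)
  singleton-count : ∀ m → m ≤ B → ∑< (suc B) (is-positive-and m) ≡ shift 1 geometric m
  singleton-count zero    _   = ∑-zero (suc B) {is-positive-and 0} (λ { zero → refl ; (suc x) → refl })
  singleton-count (suc m) m<B =
    trans (∑-cong (suc B) {is-positive-and (suc m)} {λ x → 1 when does (x ≟ suc m)}
                  (λ { zero → refl ; (suc x) → refl }))
          (∑-indicator (s≤s m<B))
acUpTo≡acSeries (suc (suc s)) {B} {m} m≤B = begin
  acUpTo B m (2 + s)
    ≡⟨ acUpTo-outer B m s ⟩
  ∑[ x < suc B ] ∑[ y < suc B ] (acUpTo B (m ∸ x ∸ y) s when does (outerPair? m x y))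
    ≡⟨ ∑-cong (suc B) (λ x → ∑-cong (suc B) (λ y →
         cong (_when does (outerPair? m x y)) (acUpTo≡acSeries s (≤-trans (m∸n≤m (m ∸ x) y) (≤-trans (m∸n≤m m x) m≤B))))) ⟩
  ∑[ x < suc B ] ∑[ y < suc B ] (acSeries s (m ∸ x ∸ y) when does (outerPair? m x y))
    ≡⟨ ∑∑-outerPair (acSeries s) m≤B ⟩
  withOuterPair (acSeries s) m ∎

ac≡acSeries : ∀ n s → ac n s ≡ acSeries s n
ac≡acSeries n s = acUpTo≡acSeries s ≤-refl

-- The formula also holds for a = 0 (through the truncated a + r ∸ 1).
corollary1 : (a n : ℕ) → 0 < a →
    (ac n (2 * a) ≡ sumR2T n (3 * a) (λ r t → 2 ^ a * ((a + r ∸ 1) C r) * ((a + t ∸ 1) C t)))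
    × (ac n (2 * a + 1) ≡ sumR2T n (3 * a + 1) (λ r t → 2 ^ a * ((a + r) C r) * ((a + t ∸ 1) C t)))
corollary1 a n _ =
  trans (ac≡acSeries n (2 * a))     (trans (acSeries-even a n) (closedForm≡sumR2T (3 * a) a)) ,
  trans (ac≡acSeries n (2 * a + 1)) (trans (acSeries-odd a n)  (closedForm≡sumR2T (3 * a + 1) (suc a)))
  where
  closedForm≡sumR2T : ∀ k b →
    shift k (2 ^ a · (geometric ⊛^ b) ⊛ stretch (geometric ⊛^ a)) n ≡
    sumR2T n k (λ r t → 2 ^ a * ((b + r ∸ 1) C r) * ((a + t ∸ 1) C t))
  closedForm≡sumR2T k b = trans
    (shift-cong k (λ m → cong (2 ^ a *_) (⊛-cong (geometric-⊛^ b) (stretch-cong (geometric-⊛^ a)) m)) n)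
    (sym (sumR2T-as-coefficient n k (2 ^ a) (λ r → (b + r ∸ 1) C r) (λ t → (a + t ∸ 1) C t)))
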